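{- Fix an integer $s\ge 0$ and let $h_s$ be the sequence defined by $h_s(1)=h_s(2)=\cdots=h_s(s+2)=1$, $h_s(s+3)=2$, and $$h_s(n)=h_s\bigl(n-s-h_s(n-1)\bigr)+h_s\bigl(n-2-s-h_s(n-3)\bigr),\qquad n>s+3.$$ Then $h_s$ is slowly growing: it is monotone nondecreasing and $h_s(n+1)-h_s(n)\in\{0,1\}$ for all $n\ge1$, so it takes every positive integer value. Moreover, every positive integer that is not a power of $2$ occurs exactly twice in the sequence $(h_s(n))_{n\ge1}$, and for every $r\ge 0$ the value $2^r$ occurs exactly $s+2$ times. -}

module Defs where

open import Data.Nat using (ℕ; zero; suc; _+_; _∸_; _≤?_; _≟_; _<_; _≤_)
open import Data.Nat.Properties using ()
open import Data.List using (List; length; filter; upTo; map)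
open import Data.Product using (Σ; _×_)
open import Relation.Nullary using (¬_; yes; no)
open import Relation.Binary.PropositionalEquality using (_≡_)

-- One step of the defining recursion of h_s at index m, given a function f
-- that is already correct on all indices < m.
--   m ≤ s+2 : 1      m = s+3 : 2
--   otherwise : f (m - s - f(m-1)) + f (m - 2 - s - f(m-3))
-- (∸ is truncated subtraction; for the true sequence all indices are in range.)
step : ℕ → (ℕ → ℕ) → ℕ → ℕ
step s f m with m ≤? suc (suc s)
... | yes _ = 1
... | no _ with m ≟ suc (suc (suc s))
...   | yes _ = 2
...   | no _ = f (m ∸ s ∸ f (m ∸ 1)) + f (m ∸ 2 ∸ s ∸ f (m ∸ 3))

-- H s k : correct values of h_s on indices 1..k (index 0 gets the dummy value 0).
H : ℕ → ℕ → ℕ → ℕ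
H s zero m = 0
H s (suc k) m with m ≤? k
... | yes _ = H s k m
... | no _ = step s (H s k) m

-- The sequence h_s (meaningful for n ≥ 1; h s 0 = 0 is a dummy value).
h : ℕ → ℕ → ℕ
h s n = H s n n

countUpTo : (ℕ → ℕ) → ℕ → ℕ → ℕ
countUpTo f v N = length (filter (λ n → f n ≟ v) (map suc (upTo N)))

OccursExactly : (ℕ → ℕ) → ℕ → ℕ → Set
OccursExactly f v k = Σ ℕ λ N → ((n : ℕ) → N < n → ¬ (f n ≡ v)) × (countUpTo f v N ≡ k)

module Submission where

-- The sequence h_s is described by its "blocks".  Define P by P 0 = 0 and
--   P n = P ⌊n/2⌋ + (s + 2⌈n/2⌉)          (n ≥ 1).
-- The block of v consists of the indices n with P v < n ≤ P (v+1); the main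
-- lemma 'h-on-block' says that h_s equals v+1 on the block of v.  All other
-- claims are then facts about P:
--   * P (v+1) - P v is s+2 if v+1 is a power of two and 2 otherwise
--     ('increment'), so blocks are nonempty, P is strictly increasing and
--     every index lies in exactly one block; consecutive indices lie in equal
--     or consecutive blocks, which gives the unit steps and monotonicity;
--   * the number of occurrences of v+1 is the length of its block.
-- 'h-on-block' is proved by strong induction on n.  For n > s+3 the first
-- term of the recurrence lands in the block of ⌊v/2⌋ ('halve', a computation
-- with the halving equations of P), the second one in the block of ⌊v'/2⌋
-- where v' is the block of n-2, and ⌊v/2⌋ + ⌊v'/2⌋ + 1 = v ('halves-sum').

open import Defs
open import Data.Nat
open import Data.Nat.Properties
open import Data.Nat.Induction using (<-rec)
open import Data.List using ([]; [_]; _++_; length; filter; upTo; map)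
import Data.List.Properties as List
open import Data.Product using (Σ; _,_; proj₁; proj₂; _×_; ∃)
open import Data.Sum using (_⊎_; inj₁; inj₂)
open import Data.Empty using (⊥; ⊥-elim)
open import Function using (_∘_)
open import Relation.Nullary using (¬_; yes; no)
open import Relation.Binary using (tri<; tri≈; tri>)
open import Relation.Binary.PropositionalEquality hiding ([_])

module Counting (f : ℕ → ℕ) (w : ℕ) where

  count-suc : ∀ N → countUpTo f w (suc N)
              ≡ countUpTo f w N + length (filter (λ n → f n ≟ w) [ suc N ])
  count-suc N = begin
      length (filter test (map suc (upTo (suc N))))
    ≡⟨ cong (λ xs → length (filter test (map suc xs))) (sym (List.upTo-∷ʳ N)) ⟩
      length (filter test (map suc (upTo N ++ [ N ])))
    ≡⟨ cong (length ∘ filter test) (List.map-++ suc (upTo N) [ N ]) ⟩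
      length (filter test (map suc (upTo N) ++ [ suc N ]))
    ≡⟨ cong length (List.filter-++ test (map suc (upTo N)) [ suc N ]) ⟩
      length (filter test (map suc (upTo N)) ++ filter test [ suc N ])
    ≡⟨ List.length-++ (filter test (map suc (upTo N))) ⟩
      countUpTo f w N + length (filter test [ suc N ]) ∎
    where
    open ≡-Reasoning
    test = λ n → f n ≟ w

  count-hit : ∀ N → f (suc N) ≡ w → countUpTo f w (suc N) ≡ suc (countUpTo f w N)
  count-hit N hit = trans (count-suc N)
    (trans (cong (λ xs → countUpTo f w N + length xs)
                 (List.filter-accept (λ n → f n ≟ w) {xs = []} hit))
           (+-comm _ 1))

  count-miss : ∀ N → f (suc N) ≢ w → countUpTo f w (suc N) ≡ countUpTo f w N
  count-miss N miss = trans (count-suc N)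
    (trans (cong (λ xs → countUpTo f w N + length xs)
                 (List.filter-reject (λ n → f n ≟ w) {xs = []} miss))
           (+-identityʳ _))

  count-none : ∀ N → (∀ n → 1 ≤ n → n ≤ N → f n ≢ w) → countUpTo f w N ≡ 0
  count-none zero    _    = refl
  count-none (suc N) none = trans (count-miss N (none (suc N) (s≤s z≤n) ≤-refl))
    (count-none N (λ n 1≤n n≤N → none n 1≤n (m≤n⇒m≤1+n n≤N)))

  count-run : ∀ N c → (∀ n → N < n → n ≤ c + N → f n ≡ w) →
              countUpTo f w (c + N) ≡ c + countUpTo f w N
  count-run N zero    _   = refl
  count-run N (suc c) run = trans (count-hit (c + N) (run (suc (c + N)) (s≤s (m≤n+m N c)) ≤-refl))
    (cong suc (count-run N c (λ n N<n n≤ → run n N<n (m≤n⇒m≤1+n n≤))))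

data EvenOdd : ℕ → Set where
  even : ∀ m → EvenOdd (m + m)
  odd  : ∀ m → EvenOdd (suc (m + m))

twice-suc : ∀ m → suc m + suc m ≡ suc (suc (m + m))
twice-suc m = cong suc (+-suc m m)

even-odd : ∀ n → EvenOdd n
even-odd zero = even 0
even-odd (suc n) with even-odd n
... | even m = odd m
... | odd m  = subst EvenOdd (twice-suc m) (even (suc m))

double-injective : ∀ {x y} → x + x ≡ y + y → x ≡ y
double-injective {x} {y} eq = trans (n≡⌊n+n/2⌋ x) (trans (cong ⌊_/2⌋ eq) (sym (n≡⌊n+n/2⌋ y)))

consecutive-halves : ∀ w → suc ⌊ suc w /2⌋ + suc ⌊ w /2⌋ ≡ suc (suc w)
consecutive-halves w = cong suc (trans (+-suc ⌈ w /2⌉ ⌊ w /2⌋)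
  (cong suc (trans (+-comm ⌈ w /2⌉ ⌊ w /2⌋) (⌊n/2⌋+⌈n/2⌉≡n w))))

equal-halves : ∀ m → suc ⌊ suc (m + m) /2⌋ + suc ⌊ suc (m + m) /2⌋ ≡ suc (suc (m + m))
equal-halves m = trans (cong (λ x → suc x + suc x) (sym (n≡⌈n+n/2⌉ m))) (twice-suc m)

plus-suc : ∀ a b c → a + (b + suc c) ≡ suc (a + (b + c))
plus-suc a b c = trans (cong (a +_) (+-suc b c)) (+-suc a (b + c))

IsPowerOf2 : ℕ → Set
IsPowerOf2 w = ∃ λ r → w ≡ 2 ^ r

twice-is-double : ∀ x → 2 * x ≡ x + x
twice-is-double x = cong (x +_) (+-identityʳ x)

pow-double : ∀ {x} → IsPowerOf2 x → IsPowerOf2 (x + x)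
pow-double (r , refl) = suc r , sym (twice-is-double (2 ^ r))

pow-halve : ∀ {x} → IsPowerOf2 (suc x + suc x) → IsPowerOf2 (suc x)
pow-halve {x} (zero , eq) = ⊥-elim (1+n≢0 (suc-injective (trans (sym (twice-suc x)) eq)))
pow-halve (suc r , eq) = r , double-injective (trans eq (twice-is-double (2 ^ r)))

odd-not-pow : ∀ x → ¬ IsPowerOf2 (suc (suc x + suc x))
odd-not-pow x (zero , ())
odd-not-pow x (suc r , eq) =
  even≢odd (2 ^ r) (suc x) (sym (trans (cong suc (twice-is-double (suc x))) eq))

module Sequence (s : ℕ) where

  h-unfold : ∀ k → h s (suc k) ≡ step s (H s k) (suc k)
  h-unfold k with suc k ≤? k
  ... | yes k<k = ⊥-elim (<-irrefl refl k<k)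
  ... | no _    = refl

  H-agrees : ∀ {k m} → m ≤ k → H s k m ≡ h s m
  H-agrees {zero} z≤n = refl
  H-agrees {suc k} {m} m≤1+k with m ≤? k
  ... | yes m≤k = H-agrees m≤k
  ... | no m≰k with ≤-antisym m≤1+k (≰⇒> m≰k)
  ...   | refl = sym (h-unfold k)

  step-low : ∀ f m → m ≤ suc (suc s) → step s f m ≡ 1
  step-low f m m≤ with m ≤? suc (suc s)
  ... | yes _ = refl
  ... | no m≰ = ⊥-elim (m≰ m≤)

  step-third : ∀ f → step s f (3 + s) ≡ 2
  step-third f with 3 + s ≤? suc (suc s)
  ... | yes 3+s≤2+s = ⊥-elim (<-irrefl refl 3+s≤2+s)
  ... | no _ with 3 + s ≟ 3 + s
  ...   | yes _   = refl
  ...   | no ≢refl = ⊥-elim (≢refl refl)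

  step-high : ∀ f m → 3 + s < m →
              step s f m ≡ f (m ∸ s ∸ f (m ∸ 1)) + f (m ∸ 2 ∸ s ∸ f (m ∸ 3))
  step-high f m lt with m ≤? suc (suc s)
  ... | yes m≤ = ⊥-elim (<⇒≱ lt (m≤n⇒m≤1+n m≤))
  ... | no _ with m ≟ 3 + s
  ...   | yes refl = ⊥-elim (<-irrefl refl lt)
  ...   | no _     = refl

  h-initial : ∀ n → 1 ≤ n → n ≤ suc (suc s) → h s n ≡ 1
  h-initial (suc k) _ n≤ = trans (h-unfold k) (step-low _ _ n≤)

  h-third : h s (3 + s) ≡ 2
  h-third = trans (h-unfold (suc (suc s))) (step-third _)

  first-index≤ : ∀ k {a} → 1 ≤ a → suc k ∸ s ∸ a ≤ k
  first-index≤ k {suc a} _ = ≤-trans (∸-monoˡ-≤ (suc a) (m∸n≤m (suc k) s)) (m∸n≤m k a)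

  -- The recurrence of h_s for n = k+1 > s+3, valid once h_s(k) ≥ 1 keeps the
  -- first index below n.
  h-rec : ∀ k → 3 + s < suc k → 1 ≤ h s k →
          h s (suc k) ≡ h s (suc k ∸ s ∸ h s k) + h s (suc k ∸ 2 ∸ s ∸ h s (suc k ∸ 3))
  h-rec k lt pos = begin
      h s (suc k)
    ≡⟨ h-unfold k ⟩
      step s (H s k) (suc k)
    ≡⟨ step-high (H s k) (suc k) lt ⟩
      H s k (suc k ∸ s ∸ H s k k) + H s k (suc k ∸ 2 ∸ s ∸ H s k (suc k ∸ 3))
    ≡⟨ cong₂ (λ a b → H s k (suc k ∸ s ∸ a) + H s k (suc k ∸ 2 ∸ s ∸ b))
             (H-agrees {k} ≤-refl) (H-agrees (m∸n≤m k 2)) ⟩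
      H s k (suc k ∸ s ∸ h s k) + H s k (suc k ∸ 2 ∸ s ∸ h s (suc k ∸ 3))
    ≡⟨ cong₂ _+_ (H-agrees (first-index≤ k pos)) (H-agrees second≤) ⟩
      h s (suc k ∸ s ∸ h s k) + h s (suc k ∸ 2 ∸ s ∸ h s (suc k ∸ 3)) ∎
    where
    open ≡-Reasoning
    second≤ : suc k ∸ 2 ∸ s ∸ h s (suc k ∸ 3) ≤ k
    second≤ = ≤-trans (m∸n≤m _ (h s (suc k ∸ 3))) (≤-trans (m∸n≤m _ s) (m∸n≤m k 1))

  -- P n computed with a fuel bound f ≥ n, since ⌊n/2⌋ is not a
  -- structural subterm of n.
  P-fuel : ℕ → ℕ → ℕ
  P-fuel zero    _       = 0
  P-fuel (suc f) zero    = 0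
  P-fuel (suc f) (suc n) = P-fuel f ⌊ suc n /2⌋ + (s + (⌈ suc n /2⌉ + ⌈ suc n /2⌉))

  P-fuel-zero : ∀ f → P-fuel f 0 ≡ 0
  P-fuel-zero zero    = refl
  P-fuel-zero (suc f) = refl

  P-fuel-stable : ∀ {f g n} → n ≤ f → n ≤ g → P-fuel f n ≡ P-fuel g n
  P-fuel-stable {f} {g} {zero} _ _ = trans (P-fuel-zero f) (sym (P-fuel-zero g))
  P-fuel-stable {suc f} {suc g} {suc n} (s≤s n≤f) (s≤s n≤g) =
    cong (_+ (s + (⌈ suc n /2⌉ + ⌈ suc n /2⌉)))
         (P-fuel-stable (≤-trans half≤ n≤f) (≤-trans half≤ n≤g))
    where half≤ = ≤-pred (⌊n/2⌋<n n)

  opaque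
    P : ℕ → ℕ
    P n = P-fuel n n

    P-zero : P 0 ≡ 0
    P-zero = refl

    P-unfold : ∀ n → P (suc n) ≡ P ⌊ suc n /2⌋ + (s + (⌈ suc n /2⌉ + ⌈ suc n /2⌉))
    P-unfold n = cong (_+ (s + (⌈ suc n /2⌉ + ⌈ suc n /2⌉)))
                      (P-fuel-stable (≤-pred (⌊n/2⌋<n n)) ≤-refl)

  P-odd : ∀ m → P (suc (m + m)) ≡ P m + (s + (suc m + suc m))
  P-odd m = trans (P-unfold (m + m))
    (cong₂ (λ a b → P a + (s + (b + b))) (sym (n≡⌈n+n/2⌉ m)) (cong suc (sym (n≡⌊n+n/2⌋ m))))

  P-even : ∀ m → P (suc m + suc m) ≡ P (suc m) + (s + (suc m + suc m))
  P-even m = trans (P-unfold (m + suc m))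
    (cong₂ (λ a b → P a + (s + (b + b))) (sym (n≡⌊n+n/2⌋ (suc m))) (sym (n≡⌈n+n/2⌉ (suc m))))

  P-one : P 1 ≡ suc (suc s)
  P-one = trans (P-unfold 0) (trans (cong (_+ (s + 2)) P-zero) (+-comm s 2))

  P-odd-step : ∀ m → P (suc (suc m + suc m)) ≡ 2 + P (suc m + suc m)
  P-odd-step m = begin
      P (suc (suc m + suc m))
    ≡⟨ P-odd (suc m) ⟩
      P (suc m) + (s + (suc (suc m) + suc (suc m)))
    ≡⟨ cong (λ x → P (suc m) + (s + x)) (twice-suc (suc m)) ⟩
      P (suc m) + (s + suc (suc (suc m + suc m)))
    ≡⟨ trans (plus-suc (P (suc m)) s _) (cong suc (plus-suc (P (suc m)) s _)) ⟩
      2 + (P (suc m) + (s + (suc m + suc m)))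
    ≡⟨ cong (2 +_) (sym (P-even m)) ⟩
      2 + P (suc m + suc m) ∎
    where open ≡-Reasoning

  P-double-step : ∀ {m d} → P (suc m) ≡ d + P m → P (suc (suc (m + m))) ≡ d + P (suc (m + m))
  P-double-step {m} {d} eq = begin
      P (suc (suc (m + m)))
    ≡⟨ cong P (sym (twice-suc m)) ⟩
      P (suc m + suc m)
    ≡⟨ P-even m ⟩
      P (suc m) + (s + (suc m + suc m))
    ≡⟨ cong (_+ (s + (suc m + suc m))) eq ⟩
      d + P m + (s + (suc m + suc m))
    ≡⟨ +-assoc d (P m) _ ⟩
      d + (P m + (s + (suc m + suc m)))
    ≡⟨ cong (d +_) (sym (P-odd m)) ⟩
      d + P (suc (m + m)) ∎
    where open ≡-Reasoning

  Increment : ℕ → Set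
  Increment v = (IsPowerOf2 (suc v) × P (suc v) ≡ (s + 2) + P v)
              ⊎ (¬ IsPowerOf2 (suc v) × P (suc v) ≡ 2 + P v)

  increment : ∀ v → Increment v
  increment = <-rec Increment go
    where
    go : ∀ v → (∀ {w} → w < v → Increment w) → Increment v
    go v rec with even-odd v
    ... | even zero    = inj₁ ((0 , refl) , trans (P-unfold 0) (+-comm (P 0) (s + 2)))
    ... | even (suc m) = inj₂ (odd-not-pow m , P-odd-step m)
    ... | odd m with rec {m} (s≤s (m≤m+n m m))
    ...   | inj₁ (pow , eq)  = inj₁ (subst IsPowerOf2 (twice-suc m) (pow-double pow) , P-double-step {m} eq)
    ...   | inj₂ (npow , eq) = inj₂ (npow ∘ pow-halve ∘ subst IsPowerOf2 (sym (twice-suc m)) , P-double-step {m} eq)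

  gap : ∀ v → 2 + P v ≤ P (suc v)
  gap v with increment v
  ... | inj₁ (_ , eq) = subst (2 + P v ≤_) (sym eq) (+-monoˡ-≤ (P v) (m≤n+m 2 s))
  ... | inj₂ (_ , eq) = ≤-reflexive (sym eq)

  P-< : ∀ v → P v < P (suc v)
  P-< v = ≤-trans (n≤1+n _) (gap v)

  P-mono : ∀ {a b} → a ≤ b → P a ≤ P b
  P-mono = go ∘ ≤⇒≤′
    where
    go : ∀ {a b} → a ≤′ b → P a ≤ P b
    go ≤′-refl         = ≤-refl
    go (≤′-step {n} a≤′b) = ≤-trans (go a≤′b) (<⇒≤ (P-< n))

  P-cancel-< : ∀ {a b} → P a < P b → a < b
  P-cancel-< Pa<Pb = ≰⇒> (λ b≤a → <⇒≱ Pa<Pb (P-mono b≤a))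

  Block : ℕ → ℕ → Set
  Block v n = P v < n × n ≤ P (suc v)

  relabel : ∀ {v w n} → v ≡ w → Block v n → Block w n
  relabel refl b = b

  block-positive : ∀ {v n} → Block v n → 1 ≤ n
  block-positive (Pv<n , _) = ≤-trans (s≤s z≤n) Pv<n

  block-start : ∀ v → Block v (suc (P v))
  block-start v = ≤-refl , ≤-trans (n≤1+n _) (gap v)

  block-end : ∀ v → Block v (P (suc v))
  block-end v = P-< v , ≤-refl

  Block-≤ : ∀ {u v m n} → Block u m → Block v n → m ≤ n → u ≤ v
  Block-≤ (Pu<m , _) (_ , n≤Pv) m≤n = ≤-pred (P-cancel-< (<-≤-trans Pu<m (≤-trans m≤n n≤Pv)))

  block-unique : ∀ {u v n} → Block u n → Block v n → u ≡ v
  block-unique bu bv = ≤-antisym (Block-≤ bu bv ≤-refl) (Block-≤ bv bu ≤-refl)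

  block-next : ∀ {v n} → Block v n → Block v (suc n) ⊎ Block (suc v) (suc n)
  block-next {v} (Pv<n , n≤P) with m≤n⇒m<n∨m≡n n≤P
  ... | inj₁ n<P  = inj₁ (≤-trans Pv<n (n≤1+n _) , n<P)
  ... | inj₂ refl = inj₂ (block-start (suc v))

  block-exists : ∀ k → Σ ℕ λ v → Block v (suc k)
  block-exists zero = 0 , s≤s (≤-reflexive P-zero) , subst (1 ≤_) (sym P-one) (s≤s z≤n)
  block-exists (suc k) with block-exists k
  ... | v , b with block-next b
  ...   | inj₁ b′ = v , b′
  ...   | inj₂ b′ = suc v , b′

  -- Since every block has at least two elements, indices at distance at
  -- most two lie in equal or consecutive blocks.
  adjacent : ∀ {u v m n} → Block u m → Block v n → m ≤ n → n ≤ 2 + m → v ≡ u ⊎ v ≡ suc u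
  adjacent {u} {v} {m} {n} bu@(_ , m≤P) bv@(Pv<n , _) m≤n n≤2+m with m≤n⇒m<n∨m≡n (Block-≤ bu bv m≤n)
  ... | inj₂ u≡v = inj₁ (sym u≡v)
  ... | inj₁ u<v = inj₂ (≤-antisym (≤-pred v<2+u) u<v)
    where
    v<2+u : v < suc (suc u)
    v<2+u = P-cancel-< (<-≤-trans Pv<n (≤-trans n≤2+m (≤-trans (+-monoʳ-≤ 2 m≤P) (gap (suc u)))))

  short-block : ∀ {v k} → P (suc v) ≡ 2 + P v → Block v k → Block v (2 + k) → ⊥
  short-block eq (Pv<k , _) (_ , 2+k≤P) = <⇒≱ Pv<k (≤-pred (≤-pred (≤-trans 2+k≤P (≤-reflexive eq))))

  shift : ∀ {w n} c → P w + c < n → n ≤ P (suc w) + c → Block w (n ∸ c)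
  shift {w} {n} c lower upper =
    m+n≤o⇒m≤o∸n (suc (P w)) lower ,
    ≤-trans (∸-monoˡ-≤ c upper) (≤-reflexive (m+n∸n≡m (P (suc w)) c))

  halve-zero : ∀ {k} → suc (suc s) ≤ suc k → Block 0 (suc k) → Block 0 (suc k ∸ (s + 1))
  halve-zero {k} big (_ , k<P1) = shift (s + 1) lower upper
    where
    lower : P 0 + (s + 1) < suc k
    lower = subst (_< suc k) (sym (cong₂ _+_ P-zero (+-comm s 1))) big
    upper : suc k ≤ P 1 + (s + 1)
    upper = ≤-trans k<P1 (m≤m+n (P 1) (s + 1))

  halve-odd-inner : ∀ {m k} → Block (suc (m + m)) (suc k) →
                    Block m (suc k ∸ (s + suc (suc (m + m))))
  halve-odd-inner {m} {k} (lo , hi) = shift (s + suc (suc (m + m))) lower upper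
    where
    open ≤-Reasoning
    lower : P m + (s + suc (suc (m + m))) < suc k
    lower = begin-strict
      P m + (s + suc (suc (m + m))) ≡⟨ cong (λ x → P m + (s + x)) (sym (twice-suc m)) ⟩
      P m + (s + (suc m + suc m))   ≡⟨ sym (P-odd m) ⟩
      P (suc (m + m))               <⟨ lo ⟩
      suc k                         ∎
    upper : suc k ≤ P (suc m) + (s + suc (suc (m + m)))
    upper = begin
      suc k                                ≤⟨ hi ⟩
      P (suc (suc (m + m)))                ≡⟨ cong P (sym (twice-suc m)) ⟩
      P (suc m + suc m)                    ≡⟨ P-even m ⟩
      P (suc m) + (s + (suc m + suc m))    ≡⟨ cong (λ x → P (suc m) + (s + x)) (twice-suc m) ⟩
      P (suc m) + (s + suc (suc (m + m))) ∎

  halve-odd-entry : ∀ {m k} → Block (m + m) k → Block (suc (m + m)) (suc k) →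
                    Block m (suc k ∸ (s + suc (m + m)))
  halve-odd-entry {m} {k} (_ , k≤P) bv@(lo , _) = shift (s + suc (m + m)) lower upper
    where
    open ≤-Reasoning
    lower : P m + (s + suc (m + m)) < suc k
    lower = begin-strict
      P m + (s + suc (m + m))       <⟨ +-monoʳ-< (P m) (+-monoʳ-< s ≤-refl) ⟩
      P m + (s + suc (suc (m + m))) ≡⟨ cong (λ x → P m + (s + x)) (sym (twice-suc m)) ⟩
      P m + (s + (suc m + suc m))   ≡⟨ sym (P-odd m) ⟩
      P (suc (m + m))               <⟨ lo ⟩
      suc k                         ∎
    upper : suc k ≤ P (suc m) + (s + suc (m + m))
    upper = begin
      suc k                              ≤⟨ s≤s k≤P ⟩
      suc (P (suc (m + m)))              ≡⟨ cong suc (P-odd m) ⟩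
      suc (P m + (s + (suc m + suc m)))  ≡⟨ cong (λ x → suc (P m + (s + x))) (twice-suc m) ⟩
      suc (P m + (s + suc (suc (m + m)))) ≡⟨ cong suc (plus-suc (P m) s (suc (m + m))) ⟩
      2 + P m + (s + suc (m + m))        ≤⟨ +-monoˡ-≤ (s + suc (m + m)) (gap m) ⟩
      P (suc m) + (s + suc (m + m))      ∎

  halve-even-inner : ∀ {m k} → Block (suc m + suc m) k → Block (suc m + suc m) (suc k) →
                     Block (suc m) (suc k ∸ (s + suc (suc m + suc m)))
  halve-even-inner {m} {k} (lo , _) (_ , hi) = shift (s + suc (suc m + suc m)) lower upper
    where
    open ≤-Reasoning
    lower : P (suc m) + (s + suc (suc m + suc m)) < suc k
    lower = s≤s (begin
      P (suc m) + (s + suc (suc m + suc m)) ≡⟨ plus-suc (P (suc m)) s _ ⟩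
      suc (P (suc m) + (s + (suc m + suc m))) ≡⟨ cong suc (sym (P-even m)) ⟩
      suc (P (suc m + suc m))               ≤⟨ lo ⟩
      k                                     ∎)
    upper : suc k ≤ P (suc (suc m)) + (s + suc (suc m + suc m))
    upper = begin
      suc k                                     ≤⟨ hi ⟩
      P (suc (suc m + suc m))                   ≡⟨ P-odd-step m ⟩
      2 + P (suc m + suc m)                     ≡⟨ cong (2 +_) (P-even m) ⟩
      2 + (P (suc m) + (s + (suc m + suc m)))   ≡⟨ cong suc (sym (plus-suc (P (suc m)) s _)) ⟩
      suc (P (suc m)) + (s + suc (suc m + suc m)) ≤⟨ +-monoˡ-≤ _ (P-< (suc m)) ⟩
      P (suc (suc m)) + (s + suc (suc m + suc m)) ∎

  halve-even-entry : ∀ {m k} → Block (m + suc m) k → Block (suc m + suc m) (suc k) →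
                     Block (suc m) (suc k ∸ (s + (suc m + suc m)))
  halve-even-entry {m} {k} (_ , k≤P) (lo , _) = shift (s + (suc m + suc m)) lower upper
    where
    open ≤-Reasoning
    lower : P (suc m) + (s + (suc m + suc m)) < suc k
    lower = subst (_< suc k) (P-even m) lo
    upper : suc k ≤ P (suc (suc m)) + (s + (suc m + suc m))
    upper = begin
      suc k                                  ≤⟨ s≤s k≤P ⟩
      suc (P (suc m + suc m))                ≡⟨ cong suc (P-even m) ⟩
      suc (P (suc m)) + (s + (suc m + suc m)) ≤⟨ +-monoˡ-≤ _ (P-< (suc m)) ⟩
      P (suc (suc m)) + (s + (suc m + suc m)) ∎

  halve : ∀ {u v k} → suc (suc s) ≤ suc k → Block u k → Block v (suc k) →
          Block ⌊ v /2⌋ (suc k ∸ s ∸ suc u)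
  halve {u} {v} {k} big bu bv rewrite ∸-+-assoc (suc k) s (suc u)
    with even-odd v | adjacent bu bv (n≤1+n k) (n≤1+n (suc k))
  ... | even zero    | inj₁ refl = halve-zero big bv
  ... | even (suc m) | inj₁ refl = relabel (n≡⌊n+n/2⌋ (suc m)) (halve-even-inner bu bv)
  ... | even (suc m) | inj₂ refl = relabel (n≡⌊n+n/2⌋ (suc m)) (halve-even-entry bu bv)
  ... | odd m        | inj₁ refl = relabel (n≡⌈n+n/2⌉ m) (halve-odd-inner bv)
  ... | odd m        | inj₂ refl = relabel (n≡⌈n+n/2⌉ m) (halve-odd-entry bu bv)

  halves-sum : ∀ {v v′ k} → 1 ≤ v → Block v′ k → Block v (2 + k) →
               suc ⌊ v /2⌋ + suc ⌊ v′ /2⌋ ≡ suc v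
  halves-sum {v} {v′} {k} 1≤v b′ b with even-odd v | adjacent b′ b (m≤n+m k 2) ≤-refl
  ... | _            | inj₂ refl = consecutive-halves v′
  halves-sum () _ _ | even zero | inj₁ refl
  ... | even (suc m) | inj₁ refl = ⊥-elim (short-block (P-odd-step m) b′ b)
  ... | odd m        | inj₁ refl = equal-halves m

  HOnBlock : ℕ → Set
  HOnBlock n = ∀ {v} → Block v n → h s n ≡ suc v

  h-high : ∀ n → 3 + s < n → (∀ {m} → m < n → HOnBlock m) → HOnBlock n
  h-high 0 ()
  h-high 1 (s≤s ())
  h-high 2 (s≤s (s≤s ()))
  h-high 3 (s≤s (s≤s (s≤s ())))
  h-high (suc (suc (suc (suc j)))) lt@(s≤s (s≤s (s≤s (s≤s s≤j)))) ih {v} b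
    with block-exists j | block-exists (suc j) | block-exists (suc (suc j))
  ... | u₃ , b₃ | v′ , b₂ | u , b₁ = begin
      h s (4 + j)
    ≡⟨ h-rec (3 + j) lt (subst (1 ≤_) (sym h₁) (s≤s z≤n)) ⟩
      h s (4 + j ∸ s ∸ h s (3 + j)) + h s (2 + j ∸ s ∸ h s (1 + j))
    ≡⟨ cong₂ (λ a c → h s (4 + j ∸ s ∸ a) + h s (2 + j ∸ s ∸ c)) h₁ h₃ ⟩
      h s (4 + j ∸ s ∸ suc u) + h s (2 + j ∸ s ∸ suc u₃)
    ≡⟨ cong₂ _+_ (ih (s≤s (first-index≤ (3 + j) (s≤s z≤n))) (halve big₁ b₁ b))
                 (ih (s≤s (≤-trans (first-index≤ (suc j) (s≤s z≤n)) (m≤n+m (suc j) 2)))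
                     (halve big₂ b₃ b₂)) ⟩
      suc ⌊ v /2⌋ + suc ⌊ v′ /2⌋
    ≡⟨ halves-sum 1≤v b₂ b ⟩
      suc v ∎
    where
    open ≡-Reasoning
    h₁ : h s (3 + j) ≡ suc u
    h₁ = ih ≤-refl b₁
    h₃ : h s (1 + j) ≡ suc u₃
    h₃ = ih (s≤s (m≤n+m (suc j) 2)) b₃
    big₂ : suc (suc s) ≤ 2 + j
    big₂ = s≤s (s≤s s≤j)
    big₁ : suc (suc s) ≤ 4 + j
    big₁ = ≤-trans big₂ (m≤n+m (2 + j) 2)
    1≤v : 1 ≤ v
    1≤v = Block-≤ (block-start 1) b (subst (_≤ 4 + j) (sym (cong suc P-one)) (<⇒≤ lt))

  -- Main lemma, by strong induction on the index: the initial values are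
  -- the blocks of 0 and the first index of the block of 1.
  h-on-block : ∀ n → HOnBlock n
  h-on-block = <-rec HOnBlock go
    where
    go : ∀ n → (∀ {m} → m < n → HOnBlock m) → HOnBlock n
    go n ih b with <-cmp n (3 + s)
    ... | tri< n<3+s _ _ = trans (h-initial n (block-positive b) (≤-pred n<3+s))
                                 (cong suc (block-unique first b))
      where
      first : Block 0 n
      first = subst (_< n) (sym P-zero) (block-positive b) , subst (n ≤_) (sym P-one) (≤-pred n<3+s)
    ... | tri≈ _ refl _ = trans h-third
                                (cong suc (block-unique (subst (Block 1) (cong suc P-one) (block-start 1)) b))
    ... | tri> _ _ 3+s<n = h-high n 3+s<n ih b

  h-inverse : ∀ {v k} → h s (suc k) ≡ suc v → Block v (suc k)
  h-inverse {v} {k} eq with block-exists k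
  ... | w , b = relabel (suc-injective (trans (sym (h-on-block _ b)) eq)) b

  -- Consecutive indices lie in equal or consecutive blocks.
  unit-steps : (n : ℕ) → 1 ≤ n → (h s (suc n) ≡ h s n) ⊎ (h s (suc n) ≡ suc (h s n))
  unit-steps (suc k) _ with block-exists k
  ... | v , b with block-next b
  ...   | inj₁ b′ = inj₁ (trans (h-on-block _ b′) (sym (h-on-block _ b)))
  ...   | inj₂ b′ = inj₂ (trans (h-on-block _ b′) (cong suc (sym (h-on-block _ b))))

  monotone : (m n : ℕ) → 1 ≤ m → m ≤ n → h s m ≤ h s n
  monotone (suc i) (suc k) _ m≤n with block-exists i | block-exists k
  ... | u , bu | v , bv = begin
      h s (suc i) ≡⟨ h-on-block _ bu ⟩
      suc u       ≤⟨ s≤s (Block-≤ bu bv m≤n) ⟩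
      suc v       ≡⟨ sym (h-on-block _ bv) ⟩
      h s (suc k) ∎
    where open ≤-Reasoning

  surjective : (v : ℕ) → 1 ≤ v → Σ ℕ λ n → (1 ≤ n) × (h s n ≡ v)
  surjective (suc v) _ = P (suc v) , block-positive (block-end v) , h-on-block _ (block-end v)

  occurs-block : ∀ v c → P (suc v) ≡ c + P v → OccursExactly (h s) (suc v) c
  occurs-block v c eq = P (suc v) , after , count
    where
    open Counting (h s) (suc v)
    after : ∀ n → P (suc v) < n → h s n ≢ suc v
    after (suc k) P<n hit = <⇒≱ P<n (proj₂ (h-inverse hit))
    before : ∀ n → 1 ≤ n → n ≤ P v → h s n ≢ suc v
    before (suc k) _ n≤P hit = <⇒≱ (proj₁ (h-inverse hit)) n≤P
    count : countUpTo (h s) (suc v) (P (suc v)) ≡ c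
    count = begin
        countUpTo (h s) (suc v) (P (suc v))
      ≡⟨ cong (countUpTo (h s) (suc v)) eq ⟩
        countUpTo (h s) (suc v) (c + P v)
      ≡⟨ count-run (P v) c (λ n Pv<n n≤ → h-on-block n (Pv<n , subst (n ≤_) (sym eq) n≤)) ⟩
        c + countUpTo (h s) (suc v) (P v)
      ≡⟨ cong (c +_) (count-none (P v) before) ⟩
        c + 0
      ≡⟨ +-identityʳ c ⟩
        c ∎
      where open ≡-Reasoning

  non-powers-twice : (v : ℕ) → 1 ≤ v → ¬ IsPowerOf2 v → OccursExactly (h s) v 2
  non-powers-twice (suc v) _ npow with increment v
  ... | inj₁ (pow , _) = ⊥-elim (npow pow)
  ... | inj₂ (_ , eq)  = occurs-block v 2 eq

  powers : (r : ℕ) → OccursExactly (h s) (2 ^ r) (s + 2)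
  powers r = subst (λ w → OccursExactly (h s) w (s + 2)) pred-suc
                   (power-block (increment (pred (2 ^ r))))
    where
    pred-suc : suc (pred (2 ^ r)) ≡ 2 ^ r
    pred-suc = suc-pred (2 ^ r) {{m^n≢0 2 r}}
    power-block : Increment (pred (2 ^ r)) → OccursExactly (h s) (suc (pred (2 ^ r))) (s + 2)
    power-block (inj₁ (_ , eq))    = occurs-block (pred (2 ^ r)) (s + 2) eq
    power-block (inj₂ (npow , _)) = ⊥-elim (npow (r , pred-suc))

corollary2p4 : (s : ℕ) →
    (((n : ℕ) → 1 ≤ n → (h s (suc n) ≡ h s n) ⊎ (h s (suc n) ≡ suc (h s n)))
    × ((m n : ℕ) → 1 ≤ m → m ≤ n → h s m ≤ h s n)
    × ((v : ℕ) → 1 ≤ v → Σ ℕ λ n → (1 ≤ n) × (h s n ≡ v)))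
    × ((v : ℕ) → 1 ≤ v → ¬ (∃ λ r → v ≡ 2 ^ r) → OccursExactly (h s) v 2)
    × ((r : ℕ) → OccursExactly (h s) (2 ^ r) (s + 2))
corollary2p4 s = (unit-steps , monotone , surjective) , non-powers-twice , powers
  where open Sequence s
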